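{- Let $a$ be an element of an $\omega$-complete effect monoid $M$. (1) If $na$ exists for all $n$, then $a=0$. (2) If $a^2=0$, then $a=0$. (3) If $a+a$ is defined, then $\bigwedge_n a^n=0$.
   Context: An effect algebra is a set $E$ with an element $0$, a partial binary operation $a+b$ (the partial sum), and a total complement $a\mapsto a^\perp$, such that: the sum is commutative and associative wherever defined, $a+0=a$, $a^\perp$ is the unique element with $a+a^\perp=1$ where $1:=0^\perp$, and $a+1$ defined implies $a=0$. The order is $a\le b$ iff $b=a+c$ for some $c$. An effect monoid is an effect algebra with an associative total multiplication $\cdot$ with unit $1$ which distributes over the partial sum on both sides. It is $\omega$-complete if every increasing sequence has a supremum. For $n\in\mathbb N$, $na$ denotes the $n$-fold partial sum $a+\dots+a$ (when defined). -}

module Defs where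

open import Level using (Level; _⊔_) renaming (suc to lsuc)
open import Data.Nat using (ℕ; zero; suc)
open import Data.Maybe using (Maybe; just; nothing; _>>=_)
open import Data.Product using (Σ; ∃; _×_; _,_)
open import Relation.Binary.PropositionalEquality using (_≡_)

-- An effect algebra. The partial sum is a function into Maybe:
-- a ⊕ b ≡ just c means "a+b is defined and equals c", nothing means undefined.
record EffectAlgebra (ℓ : Level) : Set (lsuc ℓ) where
  infixl 6 _⊕_
  field
    Carrier : Set ℓ
    𝟘       : Carrier
    _⊕_     : Carrier → Carrier → Maybe Carrier
    _ᗮ      : Carrier → Carrier

  𝟙 : Carrier
  𝟙 = 𝟘 ᗮ

  field
    ⊕-comm   : ∀ a b → a ⊕ b ≡ b ⊕ a
    ⊕-assoc  : ∀ a b c ab abc → a ⊕ b ≡ just ab → ab ⊕ c ≡ just abc →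
               Σ Carrier λ bc → (b ⊕ c ≡ just bc) × (a ⊕ bc ≡ just abc)
    ⊕-identʳ : ∀ a → a ⊕ 𝟘 ≡ just a
    ᗮ-sum    : ∀ a → a ⊕ (a ᗮ) ≡ just 𝟙
    ᗮ-unique : ∀ a b → a ⊕ b ≡ just 𝟙 → b ≡ a ᗮ
    ⊕-one    : ∀ a x → a ⊕ 𝟙 ≡ just x → a ≡ 𝟘

  _≤_ : Carrier → Carrier → Set ℓ
  a ≤ b = Σ Carrier λ c → a ⊕ c ≡ just b

  _·ₙ_ : ℕ → Carrier → Maybe Carrier
  zero  ·ₙ a = just 𝟘
  suc n ·ₙ a = (n ·ₙ a) >>= λ x → x ⊕ a

  IsSup : (ℕ → Carrier) → Carrier → Set ℓ
  IsSup f s = (∀ n → f n ≤ s) × (∀ u → (∀ n → f n ≤ u) → s ≤ u)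

  IsInf : (ℕ → Carrier) → Carrier → Set ℓ
  IsInf f s = (∀ n → s ≤ f n) × (∀ l → (∀ n → l ≤ f n) → l ≤ s)

  OmegaComplete : Set ℓ
  OmegaComplete = (f : ℕ → Carrier) → (∀ n → f n ≤ f (suc n)) → Σ Carrier (IsSup f)

record EffectMonoid (ℓ : Level) : Set (lsuc ℓ) where
  field
    effectAlgebra : EffectAlgebra ℓ
  open EffectAlgebra effectAlgebra public
  infixl 7 _·_
  field
    _·_      : Carrier → Carrier → Carrier
    ·-assoc  : ∀ a b c → (a · b) · c ≡ a · (b · c)
    ·-identˡ : ∀ a → 𝟙 · a ≡ a
    ·-identʳ : ∀ a → a · 𝟙 ≡ a
    ·-distribˡ : ∀ a b c s → a ⊕ b ≡ just s → (c · a) ⊕ (c · b) ≡ just (c · s)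
    ·-distribʳ : ∀ a b c s → a ⊕ b ≡ just s → (a · c) ⊕ (b · c) ≡ just (s · c)

  _^_ : Carrier → ℕ → Carrier
  a ^ zero  = 𝟙
  a ^ suc n = (a ^ n) · a

record OmegaCompleteEffectMonoid (ℓ : Level) : Set (lsuc ℓ) where
  field
    effectMonoid  : EffectMonoid ℓ
  open EffectMonoid effectMonoid public
  field
    omegaComplete : OmegaComplete

module Submission where

-- Part (1) is an Archimedean property that holds in every
-- ω-complete effect algebra: if all multiples na exist they form an
-- increasing chain with supremum s.  Writing s = a + s', cancellation of a
-- shows that s' is again an upper bound of the chain, so s ≤ s'; and
-- a + s' = s together with s ≤ s' forces a = 0 by cancellation and positivity.
--
-- Parts (2) and (3) reduce to (1) via one bookkeeping lemma: if a predicate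
-- P holds for 0 and "b + a is defined and again satisfies P" whenever P b,
-- then every multiple na exists.
--   (2) P b := b·a = 0.  Then b^⊥·a = a ≤ b^⊥, so b + a is defined, and
--       (b + a)·a = b·a + a·a = 0.
--   (3) P l := l is a lower bound of the powers a^n.  Since a^(n+1) + a^(n+1)
--       = a^n·(a + a) ≤ a^n, lower bounds are closed under +; so for a lower
--       bound l all multiples nl exist, whence l = 0 by (1).

open import Defs
open import Level using (Level)
open import Data.Nat using (ℕ; zero; suc)
open import Data.Maybe using (just; _>>=_)
open import Data.Maybe.Properties using (just-injective)
open import Data.Product using (Σ; _×_; _,_; proj₁; proj₂)
open import Relation.Binary.PropositionalEquality
  using (_≡_; refl; sym; trans; cong; subst; subst₂)

module EffectAlgebraProperties {ℓ : Level} (E : EffectAlgebra ℓ) where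
  open EffectAlgebra E

  ⊕-identˡ : ∀ x → 𝟘 ⊕ x ≡ just x
  ⊕-identˡ x = trans (⊕-comm 𝟘 x) (⊕-identʳ x)

  ⊕-assoc⁻ : ∀ a b c bc abc → b ⊕ c ≡ just bc → a ⊕ bc ≡ just abc →
             Σ Carrier λ ab → (a ⊕ b ≡ just ab) × (ab ⊕ c ≡ just abc)
  ⊕-assoc⁻ a b c bc abc b⊕c a⊕bc
    with ⊕-assoc c b a bc abc (trans (⊕-comm c b) b⊕c) (trans (⊕-comm bc a) a⊕bc)
  ... | ba , b⊕a , c⊕ba = ba , trans (⊕-comm a b) b⊕a , trans (⊕-comm ba c) c⊕ba

  ≤-trans : ∀ {x y z} → x ≤ y → y ≤ z → x ≤ z
  ≤-trans {x} (c , x⊕c) (d , y⊕d) with ⊕-assoc x c d _ _ x⊕c y⊕d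
  ... | cd , _ , x⊕cd = cd , x⊕cd

  𝟘-≤ : ∀ x → 𝟘 ≤ x
  𝟘-≤ x = x , ⊕-identˡ x

  ᗮ-involutive : ∀ a → (a ᗮ) ᗮ ≡ a
  ᗮ-involutive a = sym (ᗮ-unique (a ᗮ) a (trans (⊕-comm (a ᗮ) a) (ᗮ-sum a)))

  ᗮ-injective : ∀ {a b} → a ᗮ ≡ b ᗮ → a ≡ b
  ᗮ-injective {a} {b} eq =
    trans (sym (ᗮ-involutive a)) (trans (cong _ᗮ eq) (ᗮ-involutive b))

  -- If x + y = z then y + z^⊥ = x^⊥  (as x + (y + z^⊥) = z + z^⊥ = 1).
  ᗮ-shift : ∀ {x y z} → x ⊕ y ≡ just z → y ⊕ (z ᗮ) ≡ just (x ᗮ)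
  ᗮ-shift {x} {y} {z} x⊕y with ⊕-assoc x y (z ᗮ) z 𝟙 x⊕y (ᗮ-sum z)
  ... | w , y⊕zᗮ , x⊕w = subst (λ v → y ⊕ (z ᗮ) ≡ just v) (ᗮ-unique x w x⊕w) y⊕zᗮ

  -- Cancellation: applying ᗮ-shift twice expresses y^⊥ through x and z alone.
  ⊕-cancelˡ : ∀ {x y y' z} → x ⊕ y ≡ just z → x ⊕ y' ≡ just z → y ≡ y'
  ⊕-cancelˡ x⊕y x⊕y' = ᗮ-injective (just-injective
    (trans (sym (ᗮ-shift (ᗮ-shift x⊕y))) (ᗮ-shift (ᗮ-shift x⊕y'))))

  ⊕-cancelʳ : ∀ {x y y' z} → y ⊕ x ≡ just z → y' ⊕ x ≡ just z → y ≡ y'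
  ⊕-cancelʳ {x} {y} {y'} y⊕x y'⊕x =
    ⊕-cancelˡ (trans (⊕-comm x y) y⊕x) (trans (⊕-comm x y') y'⊕x)

  ⊕-absorb : ∀ {x s} → x ⊕ s ≡ just s → x ≡ 𝟘
  ⊕-absorb {x} {s} x⊕s = ⊕-cancelʳ x⊕s (⊕-identˡ s)

  -- Positivity: x + d = 0 forces x = 0 (then d + 1 is defined, so d = 0).
  ⊕-positive : ∀ {x d} → x ⊕ d ≡ just 𝟘 → x ≡ 𝟘
  ⊕-positive {x} {d} x⊕d with ⊕-assoc x d 𝟙 𝟘 𝟙 x⊕d (⊕-identˡ 𝟙)
  ... | d1 , d⊕𝟙 , _ with ⊕-one d d1 d⊕𝟙
  ... | refl = just-injective (trans (sym (⊕-identʳ x)) x⊕d)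

  ⊕-defined-below-ᗮ : ∀ {a b} → a ≤ (b ᗮ) → Σ Carrier λ c → b ⊕ a ≡ just c
  ⊕-defined-below-ᗮ {a} {b} (c , a⊕c) with ⊕-assoc⁻ b a c (b ᗮ) 𝟙 a⊕c (ᗮ-sum b)
  ... | ba , b⊕a , _ = ba , b⊕a

  ⊕-monoˡ-≤ : ∀ {x u v w} → x ≤ u → u ⊕ v ≡ just w →
              Σ Carrier λ z → (x ⊕ v ≡ just z) × (z ≤ w)
  ⊕-monoˡ-≤ {x} {u} {v} {w} (c , x⊕c) u⊕v with ⊕-assoc x c v u w x⊕c u⊕v
  ... | cv , c⊕v , x⊕cv with ⊕-assoc⁻ x v c cv w (trans (⊕-comm v c) c⊕v) x⊕cv
  ... | xv , x⊕v , xv⊕c = xv , x⊕v , (c , xv⊕c)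

  ⊕-mono-≤ : ∀ {x y u v w} → x ≤ u → y ≤ v → u ⊕ v ≡ just w →
             Σ Carrier λ z → (x ⊕ y ≡ just z) × (z ≤ w)
  ⊕-mono-≤ {x} {y} {u} x≤u y≤v u⊕v with ⊕-monoˡ-≤ x≤u u⊕v
  ... | xv , x⊕v , xv≤w with ⊕-monoˡ-≤ y≤v (trans (⊕-comm _ x) x⊕v)
  ... | yx , y⊕x , yx≤xv = yx , trans (⊕-comm x y) y⊕x , ≤-trans yx≤xv xv≤w

  ≤-cancelʳ : ∀ {x y u w a} → x ⊕ a ≡ just y → u ⊕ a ≡ just w → y ≤ w → x ≤ u
  ≤-cancelʳ {x} {y} {u} {w} {a} x⊕a u⊕a (c , y⊕c) with ⊕-assoc x a c y w x⊕a y⊕c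
  ... | ac , a⊕c , x⊕ac with ⊕-assoc⁻ x c a ac w (trans (⊕-comm c a) a⊕c) x⊕ac
  ... | xc , x⊕c , xc⊕a = c , trans x⊕c (cong just (⊕-cancelʳ xc⊕a u⊕a))

  summand-vanishes : ∀ {a s s'} → a ⊕ s' ≡ just s → s ≤ s' → a ≡ 𝟘
  summand-vanishes {a} {s} {s'} a⊕s' (d , s⊕d)
    with ⊕-assoc⁻ a d s s' s (trans (⊕-comm d s) s⊕d) a⊕s'
  ... | ad , a⊕d , ad⊕s = ⊕-positive (trans a⊕d (cong just (⊕-absorb ad⊕s)))

  ·ₙ-suc : ∀ n {a b} → n ·ₙ a ≡ just b → suc n ·ₙ a ≡ b ⊕ a
  ·ₙ-suc n {a} eq = cong (_>>= λ x → x ⊕ a) eq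

  multiples-exist : ∀ {ℓ'} (P : Carrier → Set ℓ') {a} → P 𝟘 →
    (∀ b → P b → Σ Carrier λ c → (b ⊕ a ≡ just c) × P c) →
    ∀ n → Σ Carrier λ b → n ·ₙ a ≡ just b
  multiples-exist P {a} P𝟘 step n = proj₁ (invariant n) , proj₁ (proj₂ (invariant n))
    where
    invariant : ∀ n → Σ Carrier λ b → (n ·ₙ a ≡ just b) × P b
    invariant zero = 𝟘 , refl , P𝟘
    invariant (suc n) with invariant n
    ... | b , na≡b , Pb with step b Pb
    ... | c , b⊕a , Pc = c , trans (·ₙ-suc n na≡b) b⊕a , Pc

  archimedean : OmegaComplete → ∀ a → (∀ n → Σ Carrier λ x → n ·ₙ a ≡ just x) → a ≡ 𝟘
  archimedean ω a mult = vanishes (ω multiple (λ n → a , step n))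
    where
    multiple : ℕ → Carrier
    multiple n = proj₁ (mult n)

    step : ∀ n → multiple n ⊕ a ≡ just (multiple (suc n))
    step n = trans (sym (·ₙ-suc n (proj₂ (mult n)))) (proj₂ (mult (suc n)))

    a≤multiple1 : a ≤ multiple 1
    a≤multiple1 = 𝟘 , trans (⊕-identʳ a) (trans (sym (⊕-identˡ a)) (proj₂ (mult 1)))

    -- With s = a + s', the element s' still bounds the chain, so s ≤ s'.
    vanishes : Σ Carrier (IsSup multiple) → a ≡ 𝟘
    vanishes (s , upper , least) = summand-vanishes a⊕s' (least s' upper')
      where
      a≤s : a ≤ s
      a≤s = ≤-trans a≤multiple1 (upper 1)
      s' : Carrier
      s' = proj₁ a≤s
      a⊕s' : a ⊕ s' ≡ just s
      a⊕s' = proj₂ a≤s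
      upper' : ∀ n → multiple n ≤ s'
      upper' n = ≤-cancelʳ (step n) (trans (⊕-comm s' a) a⊕s') (upper (suc n))

module EffectMonoidProperties {ℓ : Level} (M : EffectMonoid ℓ) where
  open EffectMonoid M
  open EffectAlgebraProperties effectAlgebra

  -- 0·x + 0·x = (0 + 0)·x = 0·x, so 0·x absorbs itself.
  ·-zeroˡ : ∀ x → 𝟘 · x ≡ 𝟘
  ·-zeroˡ x = ⊕-absorb (·-distribʳ 𝟘 𝟘 x 𝟘 (⊕-identʳ 𝟘))

  -- Multiplication on the right decreases: x·y + x·y^⊥ = x·1 = x.
  ·-decreasingʳ : ∀ x y → (x · y) ≤ x
  ·-decreasingʳ x y =
    x · (y ᗮ) , trans (·-distribˡ y (y ᗮ) x 𝟙 (ᗮ-sum y)) (cong just (·-identʳ x))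

  -- If b·a = 0 then b^⊥·a = a, since b·a + b^⊥·a = 1·a.
  ᗮ-·-annihilated : ∀ {a b} → b · a ≡ 𝟘 → (b ᗮ) · a ≡ a
  ᗮ-·-annihilated {a} {b} b·a≡𝟘 = just-injective (trans (sym (⊕-identˡ _)) 𝟘⊕bᗮa)
    where
    𝟘⊕bᗮa : 𝟘 ⊕ ((b ᗮ) · a) ≡ just a
    𝟘⊕bᗮa = subst₂ (λ u v → u ⊕ ((b ᗮ) · a) ≡ just v) b·a≡𝟘 (·-identˡ a)
              (·-distribʳ b (b ᗮ) a 𝟙 (ᗮ-sum b))

  square-zero : OmegaComplete → ∀ a → a · a ≡ 𝟘 → a ≡ 𝟘
  square-zero ω a a·a≡𝟘 = archimedean ω a (multiples-exist (λ b → b · a ≡ 𝟘) (·-zeroˡ a) step)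
    where
    -- a = b^⊥·a ≤ b^⊥ makes b + a defined, and (b + a)·a = b·a + a·a = 0.
    step : ∀ b → b · a ≡ 𝟘 → Σ Carrier λ c → (b ⊕ a ≡ just c) × (c · a ≡ 𝟘)
    step b b·a≡𝟘 with ⊕-defined-below-ᗮ (subst (_≤ (b ᗮ)) (ᗮ-·-annihilated b·a≡𝟘) (·-decreasingʳ (b ᗮ) a))
    ... | c , b⊕a = c , b⊕a , just-injective (trans (sym 𝟘⊕𝟘) (⊕-identʳ 𝟘))
      where
      𝟘⊕𝟘 : 𝟘 ⊕ 𝟘 ≡ just (c · a)
      𝟘⊕𝟘 = subst₂ (λ u v → u ⊕ v ≡ just (c · a)) b·a≡𝟘 a·a≡𝟘 (·-distribʳ b a a c b⊕a)

  powers-infimum : OmegaComplete → ∀ a → Σ Carrier (λ s → a ⊕ a ≡ just s) →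
                   IsInf (λ n → a ^ n) 𝟘
  powers-infimum ω a (s , a⊕a) = (λ n → 𝟘-≤ (a ^ n)) , lower-bound-≤-𝟘
    where
    LowerBound : Carrier → Set ℓ
    LowerBound x = ∀ n → x ≤ (a ^ n)

    double-power : ∀ n → (a ^ suc n) ⊕ (a ^ suc n) ≡ just ((a ^ n) · s)
    double-power n = ·-distribˡ a a (a ^ n) s a⊕a

    ⊕-LowerBound : ∀ x y → LowerBound x → LowerBound y →
                   Σ Carrier λ z → (x ⊕ y ≡ just z) × LowerBound z
    ⊕-LowerBound x y x≤ y≤ with ⊕-mono-≤ (x≤ 1) (y≤ 1) (double-power 0)
    ... | z , x⊕y , _ = z , x⊕y , z≤
      where
      z≤ : LowerBound z
      z≤ n with ⊕-mono-≤ (x≤ (suc n)) (y≤ (suc n)) (double-power n)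
      ... | z' , x⊕y' , z'≤ = subst (_≤ (a ^ n)) (just-injective (trans (sym x⊕y') x⊕y))
                                (≤-trans z'≤ (·-decreasingʳ (a ^ n) s))

    lower-bound-≤-𝟘 : ∀ l → LowerBound l → l ≤ 𝟘
    lower-bound-≤-𝟘 l l≤ = 𝟘 , trans (⊕-identʳ l) (cong just l≡𝟘)
      where
      l≡𝟘 : l ≡ 𝟘
      l≡𝟘 = archimedean ω l
              (multiples-exist LowerBound (λ n → 𝟘-≤ (a ^ n)) (λ b b≤ → ⊕-LowerBound b l b≤ l≤))

lemma26 : ∀ {ℓ : Level} (M : OmegaCompleteEffectMonoid ℓ) →
    let open OmegaCompleteEffectMonoid M in
    (a : Carrier) →
    (((n : ℕ) → Σ Carrier (λ x → n ·ₙ a ≡ just x)) → a ≡ 𝟘)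
    × (a · a ≡ 𝟘 → a ≡ 𝟘)
    × (Σ Carrier (λ s → a ⊕ a ≡ just s) → IsInf (λ n → a ^ n) 𝟘)
lemma26 M a =
    archimedean omegaComplete a
  , square-zero omegaComplete a
  , powers-infimum omegaComplete a
  where
  open OmegaCompleteEffectMonoid M using (effectAlgebra; effectMonoid; omegaComplete)
  open EffectAlgebraProperties effectAlgebra using (archimedean)
  open EffectMonoidProperties effectMonoid using (square-zero; powers-infimum)
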